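{- Let $G$ and $H$ be vertex-disjoint bipartite graphs, each with at least one edge, and let $G\,\dot\cup\,H$ be their disjoint union. Then \[\operatorname{fp}(G\,\dot\cup\,H)=\operatorname{fp}(G)+\operatorname{fp}(H),\qquad \nu_{\operatorname{ind}}(G\,\dot\cup\,H)=\nu_{\operatorname{ind}}(G)+\nu_{\operatorname{ind}}(H).\]
   Context: A bipartite graph is a Ferrers graph if it contains no induced copy of $2K_2$ (two disjoint edges with no other edges among their four endpoints). For a bipartite graph $G=(U,V,E)$, $\operatorname{fp}(G)$ is the minimum $k$ such that $E$ can be partitioned into $k$ sets $E_i$ with each spanning subgraph $(U,V,E_i)$ a Ferrers graph. An induced matching is a matching $M$ such that for any two distinct edges $uv,u'v'\in M$ the only edges of the graph among $\{u,v,u',v'\}$ are $uv,u'v'$; $\nu_{\operatorname{ind}}$ denotes the maximum size of an induced matching. -}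

module Defs where

open import Data.Nat using (ℕ; _+_; _≤_)
open import Data.Fin using (Fin; splitAt)
open import Data.Bool using (Bool; true; false; _∧_)
open import Data.Empty using (⊥)
open import Data.Sum using (inj₁; inj₂)
open import Data.Product using (Σ; _×_; ∃)
open import Relation.Binary.PropositionalEquality using (_≡_; _≢_)
open import Relation.Nullary using (¬_)
open import Function.Definitions using (Injective)
open import Data.Fin.Properties using (_≟_)
open import Relation.Nullary.Decidable using (⌊_⌋)

record BipGraph : Set where
  constructor bip
  field
    m : ℕ
    n : ℕ
    E : Fin m → Fin n → Bool
open BipGraph public

HasEdge : BipGraph → Set
HasEdge G = Σ (Fin (m G)) λ u → Σ (Fin (n G)) λ v → E G u v ≡ true

-- Ferrers graph: no induced 2K2, i.e. no edges uv, u'v' with u v' and u' v non-edges.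
Ferrers : (p q : ℕ) → (Fin p → Fin q → Bool) → Set
Ferrers p q A = (u u' : Fin p) (v v' : Fin q) →
  A u v ≡ true → A u' v' ≡ true → A u v' ≡ false → A u' v ≡ false → ⊥

-- A partition of E into k classes E_0..E_{k-1}: each edge gets a class c u v
-- (the value of c on non-edges is irrelevant); class i is the spanning
-- subgraph with edges {uv ∈ E | c u v = i}.
FerrersPartition : BipGraph → ℕ → Set
FerrersPartition G k = Σ (Fin (m G) → Fin (n G) → Fin k) λ c →
  (i : Fin k) → Ferrers (m G) (n G) (λ u v → E G u v ∧ ⌊ c u v ≟ i ⌋)

IsFp : BipGraph → ℕ → Set
IsFp G k = FerrersPartition G k × ((j : ℕ) → FerrersPartition G j → k ≤ j)

InducedMatching : BipGraph → ℕ → Set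
InducedMatching G k = Σ (Fin k → Fin (m G)) λ a → Σ (Fin k → Fin (n G)) λ b →
  Injective _≡_ _≡_ a × Injective _≡_ _≡_ b ×
  ((i : Fin k) → E G (a i) (b i) ≡ true) ×
  ((i j : Fin k) → i ≢ j → E G (a i) (b j) ≡ false)

IsNuInd : BipGraph → ℕ → Set
IsNuInd G k = InducedMatching G k × ((j : ℕ) → InducedMatching G j → j ≤ k)

_⊔_ : BipGraph → BipGraph → BipGraph
G ⊔ H = bip (m G + m H) (n G + n H) adj
  where
  adj : Fin (m G + m H) → Fin (n G + n H) → Bool
  adj u v with splitAt (m G) u | splitAt (n G) v
  ... | inj₁ x | inj₁ y = E G x y
  ... | inj₂ x | inj₂ y = E H x y
  ... | inj₁ _ | inj₂ _ = false
  ... | inj₂ _ | inj₁ _ = false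

{-# OPTIONS --safe #-}
-- A Ferrers graph has no induced 2K₂, while an edge of G and an edge of H always form an
-- induced 2K₂ in G ⊔ H. Hence every Ferrers class of G ⊔ H lies inside G or inside H, so a
-- partition of G ⊔ H into k classes splits into partitions of G and H with k classes in total;
-- conversely partitions of G and H, with disjoint sets of colours, combine to one of G ⊔ H.
-- Likewise an induced matching of G ⊔ H is the union of induced matchings of G and of H.
-- The hypothesis that G and H have edges is needed only because a colouring must also assign
-- (irrelevant) colours to the non-edges.
module Submission where

open import Defs
open import Level using (0ℓ)
open import Data.Nat using (ℕ; _+_; _≤_; zero; suc)
open import Data.Nat.Properties using (+-comm; +-mono-≤)
open import Data.Fin using (Fin; zero; suc; splitAt; _↑ˡ_; _↑ʳ_)
open import Data.Fin.Properties
  using (splitAt-↑ˡ; splitAt-↑ʳ; splitAt⁻¹-↑ˡ; splitAt⁻¹-↑ʳ; ↑ˡ-injective; ↑ʳ-injective; any?; _≟_)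
open import Data.Bool using (Bool; true; false; _∧_)
open import Data.Bool.Properties using (∧-conicalˡ; ∧-zeroʳ)
import Data.Bool.Properties as Bool
open import Data.Sum using (_⊎_; inj₁; inj₂; [_,_]′; fromInj₁; fromInj₂)
import Data.Sum as Sum
open import Data.Sum.Properties using (inj₁-injective; inj₂-injective)
open import Data.Sum.Algebra using (⊎-comm)
open import Data.Product using (_×_; _,_; ∃; ∃₂; proj₁; proj₂)
open import Data.Empty using (⊥; ⊥-elim)
open import Function using (_∘_; const; _↔_; Inverse; mk↔ₛ′)
open import Function.Definitions using (Injective)
open import Function.Construct.Composition using (_↔-∘_)
open import Relation.Binary.PropositionalEquality
  using (_≡_; _≢_; refl; sym; trans; cong; cong₂; subst; module ≡-Reasoning)
open import Relation.Nullary using (¬_; Dec; yes; no; contradiction)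
open import Relation.Nullary.Decidable using (⌊_⌋; _×-dec_; toSum)
open import Relation.Unary using (Pred)

data SplitView (p q : ℕ) : Fin (p + q) → Set where
  left  : (x : Fin p) → SplitView p q (x ↑ˡ q)
  right : (y : Fin q) → SplitView p q (p ↑ʳ y)

splitView : ∀ p {q} (w : Fin (p + q)) → SplitView p q w
splitView p w with splitAt p w in eq
... | inj₁ x = subst (SplitView p _) (splitAt⁻¹-↑ˡ eq) (left x)
... | inj₂ y = subst (SplitView p _) (splitAt⁻¹-↑ʳ eq) (right y)

↑ˡ≢↑ʳ : ∀ {p q} (x : Fin p) (y : Fin q) → x ↑ˡ q ≢ p ↑ʳ y
↑ˡ≢↑ʳ {p} {q} x y eq with trans (sym (splitAt-↑ˡ p x q)) (trans (cong (splitAt p) eq) (splitAt-↑ʳ p q y))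
... | ()

_⊕_ : ∀ {a b p q} → (Fin a → Fin p) → (Fin b → Fin q) → Fin (a + b) → Fin (p + q)
_⊕_ {a} {q = q} f g k = [ (λ i → f i ↑ˡ q) , (λ j → _ ↑ʳ g j) ]′ (splitAt a k)

⊕-↑ˡ : ∀ {a b p q} (f : Fin a → Fin p) (g : Fin b → Fin q) i → (f ⊕ g) (i ↑ˡ b) ≡ f i ↑ˡ q
⊕-↑ˡ {a} {b} f g i rewrite splitAt-↑ˡ a i b = refl

⊕-↑ʳ : ∀ {a b p q} (f : Fin a → Fin p) (g : Fin b → Fin q) j → (f ⊕ g) (a ↑ʳ j) ≡ p ↑ʳ g j
⊕-↑ʳ {a} {b} f g j rewrite splitAt-↑ʳ a b j = refl

⊕-injective : ∀ {a b p q} {f : Fin a → Fin p} {g : Fin b → Fin q} →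
  Injective _≡_ _≡_ f → Injective _≡_ _≡_ g → Injective _≡_ _≡_ (f ⊕ g)
⊕-injective {a} {b} {p} {q} {f} {g} f-inj g-inj {k} {k′} with splitView a k | splitView a k′
... | left i  | left i′  rewrite ⊕-↑ˡ f g i | ⊕-↑ˡ f g i′ = cong (_↑ˡ b) ∘ f-inj ∘ ↑ˡ-injective q _ _
... | right j | right j′ rewrite ⊕-↑ʳ f g j | ⊕-↑ʳ f g j′ = cong (a ↑ʳ_) ∘ g-inj ∘ ↑ʳ-injective p _ _
... | left i  | right j′ rewrite ⊕-↑ˡ f g i | ⊕-↑ʳ f g j′ = ⊥-elim ∘ ↑ˡ≢↑ʳ _ _
... | right j | left i′  rewrite ⊕-↑ʳ f g j | ⊕-↑ˡ f g i′ = ⊥-elim ∘ ↑ˡ≢↑ʳ _ _ ∘ sym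

⌊≟⌋-injective : ∀ {a b} {f : Fin a → Fin b} → Injective _≡_ _≡_ f → ∀ x y → ⌊ f x ≟ f y ⌋ ≡ ⌊ x ≟ y ⌋
⌊≟⌋-injective {f = f} f-inj x y with x ≟ y | f x ≟ f y
... | yes _    | yes _   = refl
... | no _     | no _    = refl
... | yes refl | no fx≢fx = ⊥-elim (fx≢fx refl)
... | no x≢y   | yes fx≡fy = ⊥-elim (x≢y (f-inj fx≡fy))

record FinSplit (k : ℕ) (P Q : Pred (Fin k) 0ℓ) : Set where
  field
    s t     : ℕ
    size    : s + t ≡ k
    enum    : Fin k ↔ (Fin s ⊎ Fin t)
  open Inverse enum public
  field
    P-left  : ∀ x → P (from (inj₁ x))
    Q-right : ∀ y → Q (from (inj₂ y))

  from-injective : Injective _≡_ _≡_ from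
  from-injective {z} eq = trans (sym (strictlyInverseˡ z)) (inverseˡ eq)

  to-inj₁ : (∀ {i} → P i → Q i → ⊥) → ∀ {i} → P i → ∃ λ x → to i ≡ inj₁ x
  to-inj₁ disjoint {i} p with to i in eq
  ... | inj₁ x = x , refl
  ... | inj₂ y = ⊥-elim (disjoint p (subst Q (inverseʳ (sym eq)) (Q-right y)))

  to-inj₂ : (∀ {i} → P i → Q i → ⊥) → ∀ {i} → Q i → ∃ λ y → to i ≡ inj₂ y
  to-inj₂ disjoint {i} q with to i in eq
  ... | inj₁ x = ⊥-elim (disjoint (subst P (inverseʳ (sym eq)) (P-left x)) q)
  ... | inj₂ y = y , refl

swapSplit : ∀ {k} {P Q : Pred (Fin k) 0ℓ} → FinSplit k P Q → FinSplit k Q P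
swapSplit S = record
  { s = t ; t = s ; size = trans (+-comm t s) size ; enum = ⊎-comm (Fin s) (Fin t) ↔-∘ enum
  ; P-left = Q-right ; Q-right = P-left }
  where open FinSplit S

consSplitˡ : ∀ {k} {P Q : Pred (Fin (suc k)) 0ℓ} →
  P zero → FinSplit k (P ∘ suc) (Q ∘ suc) → FinSplit (suc k) P Q
consSplitˡ {k} {P} p S = record
  { s = suc s ; t = t ; size = cong suc size ; enum = mk↔ₛ′ to′ from′ to′∘from′ from′∘to′
  ; P-left = P-left′ ; Q-right = Q-right }
  where
  open FinSplit S
  to′ : Fin (suc k) → Fin (suc s) ⊎ Fin t
  to′ zero    = inj₁ zero
  to′ (suc i) = Sum.map₁ suc (to i)
  from′ : Fin (suc s) ⊎ Fin t → Fin (suc k)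
  from′ (inj₁ zero)    = zero
  from′ (inj₁ (suc x)) = suc (from (inj₁ x))
  from′ (inj₂ y)       = suc (from (inj₂ y))
  from′-map₁ : ∀ z → from′ (Sum.map₁ suc z) ≡ suc (from z)
  from′-map₁ (inj₁ x) = refl
  from′-map₁ (inj₂ y) = refl
  to′∘from′ : ∀ z → to′ (from′ z) ≡ z
  to′∘from′ (inj₁ zero)    = refl
  to′∘from′ (inj₁ (suc x)) = cong (Sum.map₁ suc) (strictlyInverseˡ (inj₁ x))
  to′∘from′ (inj₂ y)       = cong (Sum.map₁ suc) (strictlyInverseˡ (inj₂ y))
  from′∘to′ : ∀ i → from′ (to′ i) ≡ i
  from′∘to′ zero    = refl
  from′∘to′ (suc i) = trans (from′-map₁ (to i)) (cong suc (strictlyInverseʳ i))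
  P-left′ : ∀ x → P (from′ (inj₁ x))
  P-left′ zero    = p
  P-left′ (suc x) = P-left x

splitFin : ∀ {k} {P Q : Pred (Fin k) 0ℓ} → (∀ i → P i ⊎ Q i) → FinSplit k P Q
splitFin {zero} _ = record
  { s = 0 ; t = 0 ; size = refl
  ; enum = mk↔ₛ′ (λ ()) [ (λ ()) , (λ ()) ]′ (λ { (inj₁ ()) ; (inj₂ ()) }) (λ ())
  ; P-left = λ () ; Q-right = λ () }
splitFin {suc k} P⊎Q with P⊎Q zero
... | inj₁ p = consSplitˡ p (splitFin (P⊎Q ∘ suc))
... | inj₂ q = swapSplit (consSplitˡ q (swapSplit (splitFin (P⊎Q ∘ suc))))

Adj : ℕ → ℕ → Set
Adj p q = Fin p → Fin q → Bool

Colouring : ℕ → ℕ → ℕ → Set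
Colouring p q k = Fin p → Fin q → Fin k

colourClass : ∀ {p q k} → Adj p q → Colouring p q k → Fin k → Adj p q
colourClass A c i u v = A u v ∧ ⌊ c u v ≟ i ⌋

module _ {p q k} (A : Adj p q) (c : Colouring p q k) {i : Fin k} {u : Fin p} {v : Fin q} where

  colourClass-edge : colourClass A c i u v ≡ true → A u v ≡ true
  colourClass-edge = ∧-conicalˡ (A u v) _

  colourClass-colour : colourClass A c i u v ≡ true → c u v ≡ i
  colourClass-colour e with c u v ≟ i
  ... | yes cuv≡i = cuv≡i
  ... | no _ = contradiction (trans (sym (∧-zeroʳ (A u v))) e) λ ()

  colourClass-non-edge : A u v ≡ false → colourClass A c i u v ≡ false
  colourClass-non-edge = cong (_∧ ⌊ c u v ≟ i ⌋)

  colourClass-intro : A u v ≡ true → c u v ≡ i → colourClass A c i u v ≡ true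
  colourClass-intro e cuv≡i rewrite e with c u v ≟ i
  ... | yes _ = refl
  ... | no cuv≢i = contradiction cuv≡i cuv≢i

Image₂ : ∀ {p q P Q} → (Fin p → Fin P) → (Fin q → Fin Q) → Fin P → Fin Q → Set
Image₂ f g u v = ∃₂ λ x y → f x ≡ u × g y ≡ v

module _ {p q P Q} {A : Adj p q} {B : Adj P Q} (f : Fin p → Fin P) (g : Fin q → Fin Q)
         (A≗B : ∀ u v → A u v ≡ B (f u) (g v)) where

  Ferrers-pullback : Ferrers P Q B → Ferrers p q A
  Ferrers-pullback FB u u′ v v′ e e′ n n′ =
    FB (f u) (f u′) (g v) (g v′) (trans (sym (A≗B u v)) e) (trans (sym (A≗B u′ v′)) e′)
       (trans (sym (A≗B u v′)) n) (trans (sym (A≗B u′ v)) n′)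

  Ferrers-pushforward : (∀ u v → B u v ≡ true → Image₂ f g u v) → Ferrers p q A → Ferrers P Q B
  Ferrers-pushforward covered FA u u′ v v′ e e′ n n′ with covered u v e | covered u′ v′ e′
  ... | x , y , refl , refl | x′ , y′ , refl , refl =
    FA x x′ y y′ (trans (A≗B x y) e) (trans (A≗B x′ y′) e′) (trans (A≗B x y′) n) (trans (A≗B x′ y) n′)

record StrongHom (G K : BipGraph) : Set where
  field
    mapU : Fin (m G) → Fin (m K)
    mapV : Fin (n G) → Fin (n K)
    adj-preserved : ∀ u v → E K (mapU u) (mapV v) ≡ E G u v

module _ {G K : BipGraph} (h : StrongHom G K) where
  open StrongHom h

  colourClass-pullback : ∀ {s k} {c′ : Colouring (m G) (n G) s} {c : Colouring (m K) (n K) k}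
    {ι : Fin s → Fin k} →
    Injective _≡_ _≡_ ι → (∀ u v → E G u v ≡ true → ι (c′ u v) ≡ c (mapU u) (mapV v)) →
    ∀ x u v → colourClass (E G) c′ x u v ≡ colourClass (E K) c (ι x) (mapU u) (mapV v)
  colourClass-pullback {c′ = c′} {c} {ι} ι-inj ι∘c′≡c x u v rewrite adj-preserved u v with E G u v in e
  ... | false = refl
  ... | true  = begin
    ⌊ c′ u v ≟ x ⌋                   ≡⟨ ⌊≟⌋-injective ι-inj (c′ u v) x ⟨
    ⌊ ι (c′ u v) ≟ ι x ⌋             ≡⟨ cong (λ j → ⌊ j ≟ ι x ⌋) (ι∘c′≡c u v e) ⟩
    ⌊ c (mapU u) (mapV v) ≟ ι x ⌋    ∎
    where open ≡-Reasoning

  FerrersPartition-restrict : ∀ {s k} (c : Colouring (m K) (n K) k) →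
    (∀ i → Ferrers (m K) (n K) (colourClass (E K) c i)) →
    (ι : Fin s → Fin k) → Injective _≡_ _≡_ ι →
    (c′ : Colouring (m G) (n G) s) → (∀ u v → E G u v ≡ true → ι (c′ u v) ≡ c (mapU u) (mapV v)) →
    FerrersPartition G s
  FerrersPartition-restrict c F ι ι-inj c′ ι∘c′≡c =
    c′ , λ x → Ferrers-pullback mapU mapV (colourClass-pullback {c = c} ι-inj ι∘c′≡c x) (F (ι x))

IsInducedMatching : ∀ {k} (G : BipGraph) → (Fin k → Fin (m G)) → (Fin k → Fin (n G)) → Set
IsInducedMatching G α β =
  Injective _≡_ _≡_ α × Injective _≡_ _≡_ β ×
  (∀ i → E G (α i) (β i) ≡ true) × (∀ i j → i ≢ j → E G (α i) (β j) ≡ false)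

InducedMatching-restrict : ∀ {G K j s} (h : StrongHom G K)
  {γ : Fin j → Fin (m K)} {δ : Fin j → Fin (n K)} →
  IsInducedMatching K γ δ → (ι : Fin s → Fin j) → Injective _≡_ _≡_ ι →
  (∀ x → Image₂ (StrongHom.mapU h) (StrongHom.mapV h) (γ (ι x)) (δ (ι x))) → InducedMatching G s
InducedMatching-restrict {G} {K} h {γ} {δ} (γ-inj , δ-inj , edges , non-edges) ι ι-inj lift =
  γ′ , δ′ , γ′-inj , δ′-inj , edges′ , non-edges′
  where
  open StrongHom h
  γ′ : _ → Fin (m G)
  γ′ x = proj₁ (lift x)
  δ′ : _ → Fin (n G)
  δ′ x = proj₁ (proj₂ (lift x))
  γ′≡ : ∀ x → mapU (γ′ x) ≡ γ (ι x)
  γ′≡ x = proj₁ (proj₂ (proj₂ (lift x)))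
  δ′≡ : ∀ x → mapV (δ′ x) ≡ δ (ι x)
  δ′≡ x = proj₂ (proj₂ (proj₂ (lift x)))
  adj′ : ∀ x y → E G (γ′ x) (δ′ y) ≡ E K (γ (ι x)) (δ (ι y))
  adj′ x y = trans (sym (adj-preserved (γ′ x) (δ′ y))) (cong₂ (E K) (γ′≡ x) (δ′≡ y))
  γ′-inj : Injective _≡_ _≡_ γ′
  γ′-inj {x} {y} eq = ι-inj (γ-inj (trans (sym (γ′≡ x)) (trans (cong mapU eq) (γ′≡ y))))
  δ′-inj : Injective _≡_ _≡_ δ′
  δ′-inj {x} {y} eq = ι-inj (δ-inj (trans (sym (δ′≡ x)) (trans (cong mapV eq) (δ′≡ y))))
  edges′ : ∀ x → E G (γ′ x) (δ′ x) ≡ true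
  edges′ x = trans (adj′ x x) (edges (ι x))
  non-edges′ : ∀ x y → x ≢ y → E G (γ′ x) (δ′ y) ≡ false
  non-edges′ x y x≢y = trans (adj′ x y) (non-edges (ι x) (ι y) (x≢y ∘ ι-inj))

module DisjointUnion (G H : BipGraph) where

  ⊔-adjˡ : ∀ x y → E (G ⊔ H) (x ↑ˡ m H) (y ↑ˡ n H) ≡ E G x y
  ⊔-adjˡ x y rewrite splitAt-↑ˡ (m G) x (m H) | splitAt-↑ˡ (n G) y (n H) = refl

  ⊔-adjʳ : ∀ x y → E (G ⊔ H) (m G ↑ʳ x) (n G ↑ʳ y) ≡ E H x y
  ⊔-adjʳ x y rewrite splitAt-↑ʳ (m G) (m H) x | splitAt-↑ʳ (n G) (n H) y = refl

  ⊔-adjˡʳ : ∀ x y → E (G ⊔ H) (x ↑ˡ m H) (n G ↑ʳ y) ≡ false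
  ⊔-adjˡʳ x y rewrite splitAt-↑ˡ (m G) x (m H) | splitAt-↑ʳ (n G) (n H) y = refl

  ⊔-adjʳˡ : ∀ x y → E (G ⊔ H) (m G ↑ʳ x) (y ↑ˡ n H) ≡ false
  ⊔-adjʳˡ x y rewrite splitAt-↑ʳ (m G) (m H) x | splitAt-↑ˡ (n G) y (n H) = refl

  homˡ : StrongHom G (G ⊔ H)
  homˡ = record { mapU = _↑ˡ m H ; mapV = _↑ˡ n H ; adj-preserved = ⊔-adjˡ }

  homʳ : StrongHom H (G ⊔ H)
  homʳ = record { mapU = m G ↑ʳ_ ; mapV = n G ↑ʳ_ ; adj-preserved = ⊔-adjʳ }

  InG InH : Fin (m G + m H) → Fin (n G + n H) → Set
  InG = Image₂ (_↑ˡ m H) (_↑ˡ n H)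
  InH = Image₂ (m G ↑ʳ_) (n G ↑ʳ_)

  ⊔-edge : ∀ {u v} → E (G ⊔ H) u v ≡ true → InG u v ⊎ InH u v
  ⊔-edge {u} {v} e with splitView (m G) u | splitView (n G) v
  ... | left x  | left y  = inj₁ (x , y , refl , refl)
  ... | right x | right y = inj₂ (x , y , refl , refl)
  ... | left x  | right y = contradiction (trans (sym e) (⊔-adjˡʳ x y)) λ ()
  ... | right x | left y  = contradiction (trans (sym e) (⊔-adjʳˡ x y)) λ ()

  ¬Ferrers-both-sides : ∀ {k} (c : Colouring (m G + m H) (n G + n H) k) {i} →
    Ferrers _ _ (colourClass (E (G ⊔ H)) c i) → ∀ {x y x′ y′} →
    colourClass (E (G ⊔ H)) c i (x ↑ˡ m H) (y ↑ˡ n H) ≡ true →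
    colourClass (E (G ⊔ H)) c i (m G ↑ʳ x′) (n G ↑ʳ y′) ≡ true → ⊥
  ¬Ferrers-both-sides c F {x} {y} {x′} {y′} e e′ = F _ _ _ _ e e′
    (colourClass-non-edge (E (G ⊔ H)) c (⊔-adjˡʳ x y′))
    (colourClass-non-edge (E (G ⊔ H)) c (⊔-adjʳˡ x′ y))

  module _ {a b} (cG : Colouring (m G) (n G) a) (cH : Colouring (m H) (n H) b) (junk : Fin (a + b)) where

    ⊔-colouring : Colouring (m G + m H) (n G + n H) (a + b)
    ⊔-colouring u v with splitAt (m G) u | splitAt (n G) v
    ... | inj₁ x | inj₁ y = cG x y ↑ˡ b
    ... | inj₂ x | inj₂ y = a ↑ʳ cH x y
    ... | _      | _      = junk

    ⊔-colouringˡ : ∀ x y → ⊔-colouring (x ↑ˡ m H) (y ↑ˡ n H) ≡ cG x y ↑ˡ b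
    ⊔-colouringˡ x y rewrite splitAt-↑ˡ (m G) x (m H) | splitAt-↑ˡ (n G) y (n H) = refl

    ⊔-colouringʳ : ∀ x y → ⊔-colouring (m G ↑ʳ x) (n G ↑ʳ y) ≡ a ↑ʳ cH x y
    ⊔-colouringʳ x y rewrite splitAt-↑ʳ (m G) (m H) x | splitAt-↑ʳ (n G) (n H) y = refl

  FerrersPartition-⊔ : ∀ {a b} → HasEdge G →
    FerrersPartition G a → FerrersPartition H b → FerrersPartition (G ⊔ H) (a + b)
  FerrersPartition-⊔ {a} {b} (u₀ , v₀ , _) (cG , FG) (cH , FH) = c , Ferrers-class
    where
    c : Colouring (m G + m H) (n G + n H) (a + b)
    c = ⊔-colouring cG cH (cG u₀ v₀ ↑ˡ b)
    c-ˡ : ∀ x y → c (x ↑ˡ m H) (y ↑ˡ n H) ≡ cG x y ↑ˡ b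
    c-ˡ = ⊔-colouringˡ cG cH _
    c-ʳ : ∀ x y → c (m G ↑ʳ x) (n G ↑ʳ y) ≡ a ↑ʳ cH x y
    c-ʳ = ⊔-colouringʳ cG cH _
    coveredˡ : ∀ x u v → colourClass (E (G ⊔ H)) c (x ↑ˡ b) u v ≡ true → InG u v
    coveredˡ x u v e with ⊔-edge (colourClass-edge (E (G ⊔ H)) c e)
    ... | inj₁ inG = inG
    ... | inj₂ (x′ , y′ , refl , refl) =
      ⊥-elim (↑ˡ≢↑ʳ x (cH x′ y′) (trans (sym (colourClass-colour (E (G ⊔ H)) c e)) (c-ʳ x′ y′)))
    coveredʳ : ∀ y u v → colourClass (E (G ⊔ H)) c (a ↑ʳ y) u v ≡ true → InH u v
    coveredʳ y u v e with ⊔-edge (colourClass-edge (E (G ⊔ H)) c e)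
    ... | inj₂ inH = inH
    ... | inj₁ (x′ , y′ , refl , refl) =
      ⊥-elim (↑ˡ≢↑ʳ (cG x′ y′) y (trans (sym (c-ˡ x′ y′)) (colourClass-colour (E (G ⊔ H)) c e)))
    Ferrers-class : ∀ i → Ferrers _ _ (colourClass (E (G ⊔ H)) c i)
    Ferrers-class i with splitView a i
    ... | left x  = Ferrers-pushforward (_↑ˡ m H) (_↑ˡ n H)
      (colourClass-pullback homˡ {c = c} (↑ˡ-injective b _ _) (λ u v _ → sym (c-ˡ u v)) x)
      (coveredˡ x) (FG x)
    ... | right y = Ferrers-pushforward (m G ↑ʳ_) (n G ↑ʳ_)
      (colourClass-pullback homʳ {c = c} (↑ʳ-injective a _ _) (λ u v _ → sym (c-ʳ u v)) y)
      (coveredʳ y) (FH y)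

  FerrersPartition-⊔-split : ∀ {k} → HasEdge G → HasEdge H → FerrersPartition (G ⊔ H) k →
    ∃₂ λ s t → s + t ≡ k × FerrersPartition G s × FerrersPartition H t
  FerrersPartition-⊔-split {k} (u₀ , v₀ , e₀) (_ , _ , e₁) (c , F) =
    s , t , size ,
    FerrersPartition-restrict homˡ c F (from ∘ inj₁) (inj₁-injective ∘ from-injective) cG cG-colours ,
    FerrersPartition-restrict homʳ c F (from ∘ inj₂) (inj₂-injective ∘ from-injective) cH cH-colours
    where
    UsedByG : Pred (Fin k) 0ℓ
    UsedByG i = ∃₂ λ u v → E G u v ≡ true × c (u ↑ˡ m H) (v ↑ˡ n H) ≡ i
    usedByG? : ∀ i → Dec (UsedByG i)
    usedByG? i = any? λ u → any? λ v → (E G u v Bool.≟ true) ×-dec (c (u ↑ˡ m H) (v ↑ˡ n H) ≟ i)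
    H-colour-unused : ∀ {u v} → E H u v ≡ true → ¬ UsedByG (c (m G ↑ʳ u) (n G ↑ʳ v))
    H-colour-unused {u} {v} e (u′ , v′ , e′ , c≡) =
      ¬Ferrers-both-sides c (F _)
      (colourClass-intro (E (G ⊔ H)) c (trans (⊔-adjˡ u′ v′) e′) c≡)
      (colourClass-intro (E (G ⊔ H)) c (trans (⊔-adjʳ u v) e) refl)
    open FinSplit (splitFin (toSum ∘ usedByG?))
    disjoint : ∀ {i} → UsedByG i → ¬ UsedByG i → ⊥
    disjoint used unused = unused used
    someColourG : Fin s
    someColourG = proj₁ (to-inj₁ disjoint (u₀ , v₀ , e₀ , refl))
    cG : Colouring (m G) (n G) s
    cG u v = fromInj₁ (const someColourG) (to (c (u ↑ˡ m H) (v ↑ˡ n H)))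
    cG-colours : ∀ u v → E G u v ≡ true → from (inj₁ (cG u v)) ≡ c (u ↑ˡ m H) (v ↑ˡ n H)
    cG-colours u v e with to-inj₁ disjoint (u , v , e , refl)
    ... | _ , to≡inj₁ rewrite to≡inj₁ = inverseʳ (sym to≡inj₁)
    someColourH : Fin t
    someColourH = proj₁ (to-inj₂ disjoint (H-colour-unused e₁))
    cH : Colouring (m H) (n H) t
    cH u v = fromInj₂ (const someColourH) (to (c (m G ↑ʳ u) (n G ↑ʳ v)))
    cH-colours : ∀ u v → E H u v ≡ true → from (inj₂ (cH u v)) ≡ c (m G ↑ʳ u) (n G ↑ʳ v)
    cH-colours u v e with to-inj₂ disjoint (H-colour-unused e)
    ... | _ , to≡inj₂ rewrite to≡inj₂ = inverseʳ (sym to≡inj₂)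

  IsInducedMatching-⊔ : ∀ {a b α β α′ β′} → IsInducedMatching {a} G α β → IsInducedMatching {b} H α′ β′ →
    IsInducedMatching (G ⊔ H) (α ⊕ α′) (β ⊕ β′)
  IsInducedMatching-⊔ {a} {b} {α} {β} {α′} {β′}
    (α-inj , β-inj , edges , non-edges) (α′-inj , β′-inj , edges′ , non-edges′) =
    ⊕-injective α-inj α′-inj , ⊕-injective β-inj β′-inj , edges⊔ , non-edges⊔
    where
    edges⊔ : ∀ k → E (G ⊔ H) ((α ⊕ α′) k) ((β ⊕ β′) k) ≡ true
    edges⊔ k with splitView a k
    ... | left i  rewrite ⊕-↑ˡ α α′ i | ⊕-↑ˡ β β′ i = trans (⊔-adjˡ _ _) (edges i)
    ... | right j rewrite ⊕-↑ʳ α α′ j | ⊕-↑ʳ β β′ j = trans (⊔-adjʳ _ _) (edges′ j)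
    non-edges⊔ : ∀ k k′ → k ≢ k′ → E (G ⊔ H) ((α ⊕ α′) k) ((β ⊕ β′) k′) ≡ false
    non-edges⊔ k k′ k≢k′ with splitView a k | splitView a k′
    ... | left i  | left i′  rewrite ⊕-↑ˡ α α′ i | ⊕-↑ˡ β β′ i′ =
      trans (⊔-adjˡ _ _) (non-edges i i′ (k≢k′ ∘ cong (_↑ˡ b)))
    ... | right j | right j′ rewrite ⊕-↑ʳ α α′ j | ⊕-↑ʳ β β′ j′ =
      trans (⊔-adjʳ _ _) (non-edges′ j j′ (k≢k′ ∘ cong (a ↑ʳ_)))
    ... | left i  | right j′ rewrite ⊕-↑ˡ α α′ i | ⊕-↑ʳ β β′ j′ = ⊔-adjˡʳ _ _
    ... | right j | left i′  rewrite ⊕-↑ʳ α α′ j | ⊕-↑ˡ β β′ i′ = ⊔-adjʳˡ _ _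

  InducedMatching-⊔-split : ∀ {j} → InducedMatching (G ⊔ H) j →
    ∃₂ λ s t → s + t ≡ j × InducedMatching G s × InducedMatching H t
  InducedMatching-⊔-split (γ , δ , M@(_ , _ , edges , _)) =
    s , t , size ,
    InducedMatching-restrict homˡ M (from ∘ inj₁) (inj₁-injective ∘ from-injective) P-left ,
    InducedMatching-restrict homʳ M (from ∘ inj₂) (inj₂-injective ∘ from-injective) Q-right
    where open FinSplit (splitFin (λ k → ⊔-edge (edges k)))

lemma6p1 : (G H : BipGraph) → HasEdge G → HasEdge H →
    ((a b : ℕ) → IsFp G a → IsFp H b → IsFp (G ⊔ H) (a + b)) ×
    ((a b : ℕ) → IsNuInd G a → IsNuInd H b → IsNuInd (G ⊔ H) (a + b))
lemma6p1 G H eG eH = fp , ν-ind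
  where
  open DisjointUnion G H
  fp : (a b : ℕ) → IsFp G a → IsFp H b → IsFp (G ⊔ H) (a + b)
  fp a b (PG , minG) (PH , minH) = FerrersPartition-⊔ eG PG PH , λ k PK →
    let s , t , s+t≡k , PG′ , PH′ = FerrersPartition-⊔-split eG eH PK
    in subst (a + b ≤_) s+t≡k (+-mono-≤ (minG s PG′) (minH t PH′))
  ν-ind : (a b : ℕ) → IsNuInd G a → IsNuInd H b → IsNuInd (G ⊔ H) (a + b)
  ν-ind a b ((α , β , MG) , maxG) ((α′ , β′ , MH) , maxH) =
    (α ⊕ α′ , β ⊕ β′ , IsInducedMatching-⊔ MG MH) , λ j MK →
      let s , t , s+t≡j , MG′ , MH′ = InducedMatching-⊔-split MK
      in subst (_≤ a + b) s+t≡j (+-mono-≤ (maxG s MG′) (maxH t MH′))
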